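{- Let $H$ be a prime tournament, and suppose there exist constants $c>0$ and $\epsilon>0$ such that every $H$-free tournament $T$ contains a transitive subtournament on at least $c\,|T|^{\epsilon}$ vertices. Then every $H$-free tournament $T$ contains a transitive subtournament on at least $|T|^{\epsilon}$ vertices.
   Context: A tournament is a directed graph in which every pair of distinct vertices is joined by exactly one of the two possible arcs; it is transitive if it has no directed cycle. A tournament $T$ is $H$-free if no induced subtournament of $T$ is isomorphic to $H$. A set $S\subseteq V(H)$ is homogeneous if every vertex of $V(H)\setminus S$ is either adjacent to all vertices of $S$ or adjacent from all vertices of $S$; it is nontrivial if $1<|S|<|V(H)|$; $H$ is prime if it has no nontrivial homogeneous set. -}

module Defs where

open import Data.Nat using (ℕ; zero; suc; _+_; _*_; _^_; _≤_; _<_)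
open import Data.Bool using (Bool; true; false; not)
open import Data.Fin using (Fin; zero; suc; inject₁; fromℕ)
open import Data.Fin.Subset using (Subset; _∈_; _∉_; ∣_∣)
open import Data.Product using (Σ; ∃; _×_; _,_)
open import Data.Sum using (_⊎_)
open import Data.Empty using (⊥)
open import Relation.Nullary using (¬_)
open import Relation.Binary.PropositionalEquality using (_≡_; _≢_)
open import Function.Definitions using (Injective)
open import Data.Integer using (ℤ) renaming (∣_∣ to absℤ)
open import Data.Rational using (ℚ; ↥_; ↧ₙ_; 0ℚ) renaming (_<_ to _<ℚ_; _≤_ to _≤ℚ_)

-- A tournament on vertex set Fin n; adj i j ≡ true means the arc i → j.
record Tournament (n : ℕ) : Set where
  field
    adj    : Fin n → Fin n → Bool
    irrefl : ∀ i → adj i i ≡ false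
    tourn  : ∀ i j → i ≢ j → adj j i ≡ not (adj i j)
open Tournament public

Embeds : ∀ {h n} → Tournament h → Tournament n → Set
Embeds {h} {n} H T =
  Σ (Fin h → Fin n) λ f → Injective _≡_ _≡_ f × (∀ i j → adj T (f i) (f j) ≡ adj H i j)

Free : ∀ {h n} → Tournament h → Tournament n → Set
Free H T = ¬ Embeds H T

Homogeneous : ∀ {h} → Tournament h → Subset h → Set
Homogeneous {h} H S = ∀ (v : Fin h) → v ∉ S →
  (∀ s → s ∈ S → adj H v s ≡ true) ⊎ (∀ s → s ∈ S → adj H s v ≡ true)

Prime : ∀ {h} → Tournament h → Set
Prime {h} H = ∀ (S : Subset h) → Homogeneous H S → ¬ (1 < ∣ S ∣ × ∣ S ∣ < h)

HasCycle : ∀ {m} → (Fin m → Fin m → Bool) → Set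
HasCycle {m} A = ∃ λ ℓ → Σ (Fin (suc ℓ) → Fin m) λ c →
  Injective _≡_ _≡_ c
  × (∀ (i : Fin ℓ) → A (c (inject₁ i)) (c (suc i)) ≡ true)
  × A (c (fromℕ ℓ)) (c zero) ≡ true

HasTransSub : ∀ {n} → Tournament n → (ℕ → Set) → Set
HasTransSub {n} T P = ∃ λ m → Σ (Fin m → Fin n) λ g →
  Injective _≡_ _≡_ g × ¬ HasCycle (λ i j → adj T (g i) (g j)) × P m

-- A positive real number, represented by its (open) lower Dedekind cut
record PosReal : Set₁ where
  field
    L         : ℚ → Set
    positive  : ∃ λ q → L q × 0ℚ <ℚ q
    bounded   : ∃ λ q → ¬ L q
    downward  : ∀ {p q} → p ≤ℚ q → L q → L p
    rounded   : ∀ {q} → L q → ∃ λ p → q <ℚ p × L p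
open PosReal public

-- k ≥ c · n^ε  (for positive reals c, ε): for all rationals 0 < s < c, 0 < r < ε,
-- s · n^r ≤ k; with s = a/b, r = p/q this is a^q · n^p ≤ (k·b)^q.
AtLeast : ℕ → PosReal → PosReal → ℕ → Set
AtLeast k c ε n = ∀ s r → L c s → L ε r → 0ℚ <ℚ s → 0ℚ <ℚ r →
  absℤ (↥ s) ^ (↧ₙ r) * n ^ absℤ (↥ r) ≤ (k * ↧ₙ s) ^ (↧ₙ r)

-- k ≥ n^ε : for all rationals 0 < r = p/q < ε, n^p ≤ k^q.
AtLeastPow : ℕ → PosReal → ℕ → Set
AtLeastPow k ε n = ∀ r → L ε r → 0ℚ <ℚ r → n ^ absℤ (↥ r) ≤ k ^ (↧ₙ r)

module Submission where

-- Write α(T) for the largest transitive subtournament of T.  The idea is to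
-- apply the hypothesis α(T') ≥ c·|T'|^ε not to T itself but to its
-- lexicographic powers T' = T^E (each vertex of T replaced by a copy of
-- T^(E-1)).  Two facts about the lexicographic product T₁ ⊗ T₂ drive this:
--   * if H is prime, then T₁ ⊗ T₂ is H-free whenever T₁ and T₂ are, since an
--     embedding of H either lies in one block, meets every block at most once,
--     or cuts H into a nontrivial homogeneous set (the part in one block);
--   * α(T₁ ⊗ T₂) ≤ α(T₁)·α(T₂), since a transitive set has transitive
--     "shadow" in T₁ and transitive intersection with each block.
-- Hence T^E is H-free with α(T^E) ≤ α(T)^E, so c·n^(Eε) ≤ α(T)^E, that is
-- α(T) ≥ c^(1/E)·n^ε for every E, and letting E grow removes the constant c.

open import Defs
open import Data.Nat using (ℕ; zero; suc; _+_; _*_; _^_; _≤_; _<_; _≤?_; z≤n; s≤s; NonZero)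
open import Data.Nat.Properties
open import Data.Nat.Tactic.RingSolver using (solve-∀)
open import Data.Bool using (Bool; true; false; not; if_then_else_)
open import Data.Bool.Properties using () renaming (_≟_ to _≟ᵇ_)
open import Data.Fin using (Fin; zero; suc; toℕ; fromℕ; fromℕ<; inject₁; remQuot; combine)
open import Data.Fin.Properties using (any?; all?; injective⇒≤; toℕ-fromℕ<; combine-remQuot; ¬Fin0)
  renaming (_≟_ to _≟ᶠ_)
open import Data.Fin.Subset using (Subset; ∣_∣; ⁅_⁆) renaming (_∈_ to _∈ˢ_; _∉_ to _∉ˢ_)
open import Data.Fin.Subset.Properties using (∈⊤; ⊆⊤; ∣⊤∣≡n; ∣⁅x⁆∣≡1; x∈⁅y⁆⇒x≡y; x≢y⇒x∉⁅y⁆; p⊂q⇒∣p∣<∣q∣)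
open import Data.Vec using (tabulate)
open import Data.Vec.Properties using (lookup∘tabulate; []=⇒lookup; lookup⇒[]=)
open import Data.Vec.Functional using () renaming (_∷_ to _◂_)
open import Data.List using (List; []; _∷_; length; filter; lookup; allFin)
open import Data.List.Properties using (length-filter; length-tabulate)
open import Data.List.Relation.Unary.All as All using (All; []; _∷_)
open import Data.List.Relation.Unary.All.Properties using (all-filter)
  renaming (filter⁺ to All-filter⁺)
open import Data.List.Relation.Unary.AllPairs using (AllPairs; []; _∷_)
open import Data.List.Relation.Unary.Unique.Propositional using (Unique)
open import Data.List.Relation.Unary.Unique.Propositional.Properties using (allFin⁺)
  renaming (filter⁺ to Unique-filter⁺)
open import Data.List.Membership.Propositional using (_∈_)
open import Data.List.Membership.Propositional.Properties using (∈-lookup; ∈-filter⁻)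
open import Data.List.Relation.Unary.Any using (here; there)
open import Data.Product using (Σ; ∃; _×_; _,_; proj₁; proj₂)
open import Data.Sum using (inj₁; inj₂)
open import Data.Empty using (⊥; ⊥-elim)
open import Data.Integer as ℤ using (+_; +[1+_]; -[1+_]) renaming (∣_∣ to absℤ)
import Data.Integer.Properties as ℤ
open import Data.Rational using (mkℚ; ↥_; ↧_; ↧ₙ_; 0ℚ) renaming (_<_ to _<ℚ_)
import Data.Rational as ℚ
import Data.Rational.Properties as ℚ
open import Relation.Nullary using (¬_; Dec; yes; no; ¬?; does)
open import Relation.Nullary.Decidable using (_×-dec_; _→-dec_; map′; decidable-stable; dec-true)
open import Relation.Unary using (Decidable)
open import Relation.Binary.Definitions using (DecidableEquality; Symmetric)
open import Relation.Binary.PropositionalEquality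
open import Function using (_∘_)
open import Function.Definitions using (Injective)

Acyclic : ∀ {n k} → Tournament n → (Fin k → Fin n) → Set
Acyclic T f = ¬ HasCycle (λ i j → adj T (f i) (f j))

TransitiveSub : ∀ {n} → Tournament n → ℕ → Set
TransitiveSub {n} T k = Σ (Fin k → Fin n) λ f → Injective _≡_ _≡_ f × Acyclic T f

TransBound : ∀ {n} → Tournament n → ℕ → Set
TransBound T M = ∀ k → TransitiveSub T k → k ≤ M

cycle-restrict : ∀ {a b} (A : Fin b → Fin b → Bool) (f : Fin a → Fin b) →
  Injective _≡_ _≡_ f → HasCycle (λ i j → A (f i) (f j)) → HasCycle A
cycle-restrict A f f-inj (ℓ , c , c-inj , arcs , closing) =
  ℓ , f ∘ c , c-inj ∘ f-inj , arcs , closing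

cycle-ext : ∀ {a} {A B : Fin a → Fin a → Bool} → (∀ i j → A i j ≡ B i j) →
  HasCycle A → HasCycle B
cycle-ext A≡B (ℓ , c , c-inj , arcs , closing) =
  ℓ , c , c-inj , (λ i → trans (sym (A≡B _ _)) (arcs i)) , trans (sym (A≡B _ _)) closing

acyclic-restrict : ∀ {n a b} (T : Tournament n) {f : Fin b → Fin n} {g : Fin a → Fin b} →
  Injective _≡_ _≡_ g → Acyclic T f → Acyclic T (f ∘ g)
acyclic-restrict T {f} {g} g-inj f-acyclic cycle =
  f-acyclic (cycle-restrict (λ i j → adj T (f i) (f j)) g g-inj cycle)

-- transitivity is preserved by a vertex map that preserves the arcs between
-- distinct vertices (on the diagonal both tournaments are irreflexive)
acyclic-transfer : ∀ {n n' k} (T : Tournament n) (T' : Tournament n')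
  (f : Fin k → Fin n) (f' : Fin k → Fin n') →
  (∀ i j → i ≢ j → adj T' (f' i) (f' j) ≡ adj T (f i) (f j)) →
  Acyclic T f → Acyclic T' f'
acyclic-transfer T T' f f' agree f-acyclic cycle = f-acyclic (cycle-ext agree-everywhere cycle)
  where
    agree-everywhere : ∀ i j → adj T' (f' i) (f' j) ≡ adj T (f i) (f j)
    agree-everywhere i j with i ≟ᶠ j
    ... | yes refl = trans (irrefl T' (f' i)) (sym (irrefl T (f i)))
    ... | no i≢j   = agree i j i≢j

separating⇒injective : ∀ {k} {A : Set} (f : Fin k → A) →
  (∀ i j → i ≢ j → f i ≢ f j) → Injective _≡_ _≡_ f
separating⇒injective f separates {i} {j} fi≡fj with i ≟ᶠ j
... | yes i≡j = i≡j
... | no i≢j  = ⊥-elim (separates i j i≢j fi≡fj)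

-- T₁ ⊗ T₂ replaces every vertex of T₁ by a copy of T₂ (a "block"); arcs
-- inside a block come from T₂, arcs between blocks from T₁.
module Product {n₁ n₂} (T₁ : Tournament n₁) (T₂ : Tournament n₂) where

  block : Fin (n₁ * n₂) → Fin n₁
  block x = proj₁ (remQuot {n₁} n₂ x)

  inner : Fin (n₁ * n₂) → Fin n₂
  inner x = proj₂ (remQuot {n₁} n₂ x)

  coordinates-injective : ∀ {x y} → block x ≡ block y → inner x ≡ inner y → x ≡ y
  coordinates-injective {x} {y} b≡ i≡ = begin
    x                              ≡⟨ sym (combine-remQuot {n₁} n₂ x) ⟩
    combine (block x) (inner x)    ≡⟨ cong₂ combine b≡ i≡ ⟩
    combine (block y) (inner y)    ≡⟨ combine-remQuot {n₁} n₂ y ⟩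
    y                              ∎
    where open ≡-Reasoning

  arc : Fin (n₁ * n₂) → Fin (n₁ * n₂) → Bool
  arc x y = if does (block x ≟ᶠ block y) then adj T₂ (inner x) (inner y)
                                         else adj T₁ (block x) (block y)

  same-block : ∀ x y → block x ≡ block y → arc x y ≡ adj T₂ (inner x) (inner y)
  same-block x y b≡ with block x ≟ᶠ block y
  ... | yes _  = refl
  ... | no b≢  = ⊥-elim (b≢ b≡)

  other-block : ∀ x y → block x ≢ block y → arc x y ≡ adj T₁ (block x) (block y)
  other-block x y b≢ with block x ≟ᶠ block y
  ... | yes b≡ = ⊥-elim (b≢ b≡)
  ... | no _   = refl

  arc-tournament : ∀ x y → x ≢ y → arc y x ≡ not (arc x y)
  arc-tournament x y x≢y with block x ≟ᶠ block y
  ... | yes b≡ = trans (same-block y x (sym b≡))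
                   (tourn T₂ _ _ (λ i≡ → x≢y (coordinates-injective b≡ i≡)))
  ... | no b≢  = trans (other-block y x (b≢ ∘ sym)) (tourn T₁ _ _ b≢)

  _⊗_ : Tournament (n₁ * n₂)
  _⊗_ = record
    { adj    = arc
    ; irrefl = λ x → trans (same-block x x refl) (irrefl T₂ (inner x))
    ; tourn  = arc-tournament
    }

open Product using (_⊗_)

-- If H is prime, lexicographic products of H-free tournaments are H-free.

subset : ∀ {h} {P : Fin h → Set} → Decidable P → Subset h
subset P? = tabulate (does ∘ P?)

∈-subset⁺ : ∀ {h} {P : Fin h → Set} (P? : Decidable P) {v} → P v → v ∈ˢ subset P?
∈-subset⁺ P? {v} pv = lookup⇒[]= v _ (trans (lookup∘tabulate _ v) (dec-true (P? v) pv))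

∈-subset⁻ : ∀ {h} {P : Fin h → Set} (P? : Decidable P) {v} → v ∈ˢ subset P? → P v
∈-subset⁻ P? {v} v∈ with P? v | trans (sym (lookup∘tabulate (does ∘ P?) v)) ([]=⇒lookup v∈)
... | yes pv | _  = pv
... | no _   | ()

nontrivial : ∀ {h} {S : Subset h} {i j k} → i ∈ˢ S → j ∈ˢ S → i ≢ j → k ∉ˢ S →
  1 < ∣ S ∣ × ∣ S ∣ < h
nontrivial {h} {S} {i} {j} {k} i∈S j∈S i≢j k∉S =
  subst (_< ∣ S ∣) (∣⁅x⁆∣≡1 i) (p⊂q⇒∣p∣<∣q∣ (⁅i⁆⊆S , j , j∈S , x≢y⇒x∉⁅y⁆ (i≢j ∘ sym))) ,
  subst (∣ S ∣ <_) (∣⊤∣≡n h) (p⊂q⇒∣p∣<∣q∣ (⊆⊤ , k , ∈⊤ , k∉S))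
  where
    ⁅i⁆⊆S : ∀ {x} → x ∈ˢ ⁅ i ⁆ → x ∈ˢ S
    ⁅i⁆⊆S x∈ = subst (_∈ˢ S) (sym (x∈⁅y⁆⇒x≡y i x∈)) i∈S

module _ {h n₁ n₂} (H : Tournament h) (T₁ : Tournament n₁) (T₂ : Tournament n₂) where
  open Product T₁ T₂ hiding (_⊗_)

  module Embedding (f : Fin h → Fin (n₁ * n₂)) (f-inj : Injective _≡_ _≡_ f)
                   (f-adj : ∀ i j → arc (f i) (f j) ≡ adj H i j) where

    fiber : Fin n₁ → Subset h
    fiber x = subset (λ v → block (f v) ≟ᶠ x)

    ∈-fiber⁺ : ∀ {x} v → block (f v) ≡ x → v ∈ˢ fiber x
    ∈-fiber⁺ {x} v = ∈-subset⁺ (λ u → block (f u) ≟ᶠ x)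

    ∈-fiber⁻ : ∀ {x v} → v ∈ˢ fiber x → block (f v) ≡ x
    ∈-fiber⁻ {x} = ∈-subset⁻ (λ u → block (f u) ≟ᶠ x)

    sees-block : ∀ x v → v ∉ˢ fiber x → ∀ t → t ∈ˢ fiber x → adj H v t ≡ adj T₁ (block (f v)) x
    sees-block x v v∉ t t∈ = begin
      adj H v t                            ≡⟨ sym (f-adj v t) ⟩
      arc (f v) (f t)                      ≡⟨ other-block (f v) (f t) v-outside ⟩
      adj T₁ (block (f v)) (block (f t))   ≡⟨ cong (adj T₁ _) (∈-fiber⁻ t∈) ⟩
      adj T₁ (block (f v)) x               ∎
      where
        open ≡-Reasoning
        v-outside : block (f v) ≢ block (f t)
        v-outside b≡ = v∉ (∈-fiber⁺ v (trans b≡ (∈-fiber⁻ t∈)))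

    fiber-homogeneous : ∀ x → Homogeneous H (fiber x)
    fiber-homogeneous x v v∉ with adj T₁ (block (f v)) x in arc-to-x
    ... | true  = inj₁ λ t t∈ → trans (sees-block x v v∉ t t∈) arc-to-x
    ... | false = inj₂ λ t t∈ → trans (tourn H v t (λ { refl → v∉ t∈ }))
                                      (cong not (trans (sees-block x v v∉ t t∈) arc-to-x))

    embeds-across : (∀ i j → i ≢ j → block (f i) ≢ block (f j)) → Embeds H T₁
    embeds-across separated = block ∘ f , separating⇒injective (block ∘ f) separated , adjacency
      where
        adjacency : ∀ i j → adj T₁ (block (f i)) (block (f j)) ≡ adj H i j
        adjacency i j with i ≟ᶠ j
        ... | yes refl = trans (irrefl T₁ _) (sym (irrefl H i))
        ... | no i≢j   = trans (sym (other-block (f i) (f j) (separated i j i≢j))) (f-adj i j)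

    embeds-within : ∀ x → (∀ v → block (f v) ≡ x) → Embeds H T₂
    embeds-within x in-x = inner ∘ f , inner-inj , adjacency
      where
        same : ∀ i j → block (f i) ≡ block (f j)
        same i j = trans (in-x i) (sym (in-x j))
        inner-inj : Injective _≡_ _≡_ (inner ∘ f)
        inner-inj {i} {j} i≡ = f-inj (coordinates-injective (same i j) i≡)
        adjacency : ∀ i j → adj T₂ (inner (f i)) (inner (f j)) ≡ adj H i j
        adjacency i j = trans (sym (same-block (f i) (f j) (same i j))) (f-adj i j)

    -- For prime H the embedding cannot exist: either it meets every block at
    -- most once, or it stays inside one block, or some fiber is nontrivial.
    impossible : Prime H → Free H T₁ → Free H T₂ → ⊥
    impossible prime free₁ free₂
      with any? (λ i → any? (λ j → ¬? (i ≟ᶠ j) ×-dec (block (f i) ≟ᶠ block (f j))))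
    ... | no no-collision = free₁ (embeds-across λ i j i≢j b≡ → no-collision (i , j , i≢j , b≡))
    ... | yes (i , j , i≢j , b≡) with any? (λ k → ¬? (block (f k) ≟ᶠ block (f i)))
    ...   | no none-outside = free₂ (embeds-within (block (f i)) λ v →
              decidable-stable (block (f v) ≟ᶠ block (f i)) (λ b≢ → none-outside (v , b≢)))
    ...   | yes (k , k-outside) = prime (fiber (block (f i))) (fiber-homogeneous (block (f i)))
              (nontrivial (∈-fiber⁺ i refl) (∈-fiber⁺ j (sym b≡)) i≢j (k-outside ∘ ∈-fiber⁻))

  ⊗-free : Prime H → Free H T₁ → Free H T₂ → Free H (T₁ ⊗ T₂)
  ⊗-free prime free₁ free₂ (f , f-inj , f-adj) = Embedding.impossible f f-inj f-adj prime free₁ free₂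

-- A transitive set of T₁ ⊗ T₂ has at most α(T₁)·α(T₂) vertices.

lookup-pairwise : ∀ {Y : Set} {R : Y → Y → Set} → Symmetric R → ∀ {xs} → AllPairs R xs →
  ∀ i j → i ≢ j → R (lookup xs i) (lookup xs j)
lookup-pairwise sym-R (r ∷ rs) zero    zero    i≢j = ⊥-elim (i≢j refl)
lookup-pairwise sym-R (r ∷ rs) zero    (suc j) _   = All.lookup r (∈-lookup j)
lookup-pairwise sym-R (r ∷ rs) (suc i) zero    _   = sym-R (All.lookup r (∈-lookup i))
lookup-pairwise sym-R (r ∷ rs) (suc i) (suc j) i≢j = lookup-pairwise sym-R rs i j (i≢j ∘ cong suc)

length-partition : ∀ {Y : Set} {P : Y → Set} (P? : Decidable P) xs →
  length (filter P? xs) + length (filter (¬? ∘ P?) xs) ≡ length xs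
length-partition P? []       = refl
length-partition P? (x ∷ xs) with P? x
... | yes _ = cong suc (length-partition P? xs)
... | no _  = trans (+-suc _ _) (cong suc (length-partition P? xs))

-- Split a duplicate-free list into classes according to a key.  If every
-- class has at most B elements, then the list has at most B elements per
-- distinct key; the witnesses are one representative per class.
module Classes {Y Z : Set} (key : Y → Z) (_≟Z_ : DecidableEquality Z) (B : ℕ)
  (class-bound : ∀ z ys → Unique ys → All (λ y → key y ≡ z) ys → length ys ≤ B) where

  record Representatives (xs : List Y) : Set where
    field
      reps     : List Y
      distinct : AllPairs (λ y y' → key y ≢ key y') reps
      chosen   : All (_∈ xs) reps
      count    : length xs ≤ length reps * B

  -- by induction on a bound for the length: remove the class of the head
  representatives : ∀ n xs → length xs ≤ n → Unique xs → Representatives xs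
  representatives _ [] _ _ = record { reps = [] ; distinct = [] ; chosen = [] ; count = z≤n }
  representatives (suc n) (x ∷ rest) (s≤s len) (x∉rest ∷ uniq) = record
    { reps     = x ∷ reps
    ; distinct = new-key ∷ distinct
    ; chosen   = here refl ∷ All.map (λ y∈ → there (proj₁ (∈-filter⁻ differs? {xs = rest} y∈))) chosen
    ; count    = count′
    }
    where
      same? : Decidable (λ y → key y ≡ key x)
      same? y = key y ≟Z key x
      differs? : Decidable (λ y → ¬ key y ≡ key x)
      differs? = ¬? ∘ same?
      class  = x ∷ filter same? rest
      others = filter differs? rest
      open Representatives (representatives n others (≤-trans (length-filter differs? rest) len)
                                                     (Unique-filter⁺ differs? uniq))
      new-key : All (λ y → key x ≢ key y) reps
      new-key = All.map (λ y∈ k≡ → proj₂ (∈-filter⁻ differs? {xs = rest} y∈) (sym k≡)) chosen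
      class-size : length class ≤ B
      class-size = class-bound (key x) class
        (All-filter⁺ same? x∉rest ∷ Unique-filter⁺ same? uniq) (refl ∷ all-filter same? rest)
      count′ : suc (length rest) ≤ B + length reps * B
      count′ = begin
        suc (length rest)              ≡⟨ cong suc (sym (length-partition same? rest)) ⟩
        length class + length others   ≤⟨ +-mono-≤ class-size count ⟩
        B + length reps * B            ∎
        where open ≤-Reasoning

module _ {n₁ n₂} (T₁ : Tournament n₁) (T₂ : Tournament n₂) where
  open Product T₁ T₂ hiding (_⊗_)

  ⊗-bound : ∀ {M₁ M₂} → TransBound T₁ M₁ → TransBound T₂ M₂ → TransBound (T₁ ⊗ T₂) (M₁ * M₂)
  ⊗-bound {M₁} {M₂} bound₁ bound₂ m (g , g-inj , g-acyclic) = begin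
    m                  ≡⟨ sym (length-tabulate (λ i → i)) ⟩
    length (allFin m)  ≤⟨ count ⟩
    length reps * M₂   ≤⟨ *-monoˡ-≤ M₂ (bound₁ (length reps) shadow) ⟩
    M₁ * M₂            ∎
    where
      open ≤-Reasoning

      -- the part of a transitive set inside one block is a transitive set of T₂
      class-bound : ∀ z ys → Unique ys → All (λ y → block (g y) ≡ z) ys → length ys ≤ M₂
      class-bound z ys uniq in-z = bound₂ (length ys) (inner ∘ g ∘ lookup ys , inner-inj , acyclic)
        where
          same : ∀ i j → block (g (lookup ys i)) ≡ block (g (lookup ys j))
          same i j = trans (All.lookup in-z (∈-lookup i)) (sym (All.lookup in-z (∈-lookup j)))
          lookup-inj : Injective _≡_ _≡_ (lookup ys)
          lookup-inj = separating⇒injective (lookup ys) (lookup-pairwise ≢-sym uniq)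
          inner-inj : Injective _≡_ _≡_ (inner ∘ g ∘ lookup ys)
          inner-inj {i} {j} i≡ = lookup-inj (g-inj (coordinates-injective (same i j) i≡))
          acyclic : Acyclic T₂ (inner ∘ g ∘ lookup ys)
          acyclic = acyclic-transfer (T₁ ⊗ T₂) T₂ (g ∘ lookup ys) (inner ∘ g ∘ lookup ys)
            (λ i j _ → sym (same-block _ _ (same i j)))
            (acyclic-restrict (T₁ ⊗ T₂) {f = g} lookup-inj g-acyclic)

      open Classes (block ∘ g) _≟ᶠ_ M₂ class-bound
      open Representatives (representatives m (allFin m) (≤-reflexive (length-tabulate (λ i → i))) (allFin⁺ m))

      -- one vertex in each block met: a transitive set of T₁
      shadow : TransitiveSub T₁ (length reps)
      shadow = block ∘ g ∘ lookup reps , block-inj , acyclic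
        where
          separated : ∀ i j → i ≢ j → block (g (lookup reps i)) ≢ block (g (lookup reps j))
          separated = lookup-pairwise ≢-sym distinct
          block-inj : Injective _≡_ _≡_ (block ∘ g ∘ lookup reps)
          block-inj = separating⇒injective _ separated
          acyclic : Acyclic T₁ (block ∘ g ∘ lookup reps)
          acyclic = acyclic-transfer (T₁ ⊗ T₂) T₁ (g ∘ lookup reps) (block ∘ g ∘ lookup reps)
            (λ i j i≢j → sym (other-block _ _ (separated i j i≢j)))
            (acyclic-restrict (T₁ ⊗ T₂) {f = g} (block-inj ∘ cong (block ∘ g)) g-acyclic)

-- Lexicographic powers of a tournament.

-- n^(K+1), by the recursion that builds the powers of a tournament
pow⁺ : ℕ → ℕ → ℕ
pow⁺ n zero    = n
pow⁺ n (suc K) = n * pow⁺ n K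

pow⁺≡^ : ∀ n K → pow⁺ n K ≡ n ^ suc K
pow⁺≡^ n zero    = sym (*-identityʳ n)
pow⁺≡^ n (suc K) = cong (n *_) (pow⁺≡^ n K)

-- T^(K+1) = T ⊗ (T ⊗ (⋯ ⊗ T))
power : ∀ {n} → Tournament n → ∀ K → Tournament (pow⁺ n K)
power T zero    = T
power T (suc K) = T ⊗ power T K

power-free : ∀ {h n} (H : Tournament h) (T : Tournament n) → Prime H → Free H T →
  ∀ K → Free H (power T K)
power-free H T prime free zero    = free
power-free H T prime free (suc K) = ⊗-free H T (power T K) prime free (power-free H T prime free K)

power-bound : ∀ {n M} (T : Tournament n) → TransBound T M → ∀ K → TransBound (power T K) (M ^ suc K)
power-bound {M = M} T bound K k sub = subst (k ≤_) (pow⁺≡^ M K) (go K k sub)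
  where
    go : ∀ K → TransBound (power T K) (pow⁺ M K)
    go zero    = bound
    go (suc K) = ⊗-bound T (power T K) bound (go K)

-- Transitivity is decidable, so a largest transitive subtournament exists.

Extensional : ∀ {k m} → ((Fin k → Fin m) → Set) → Set
Extensional P = ∀ {f g} → (∀ i → f i ≡ g i) → P f → P g

∃-function? : ∀ {k m} {P : (Fin k → Fin m) → Set} → Extensional P → Decidable P → Dec (∃ P)
∃-function? {zero} P-ext P? with P? (λ ())
... | yes p = yes (_ , p)
... | no ¬p = no λ (f , pf) → ¬p (P-ext (λ ()) pf)
∃-function? {suc k} {m} {P} P-ext P? =
  map′ (λ (a , f , pf) → a ◂ f , pf)
       (λ (f , pf) → f zero , f ∘ suc , P-ext (λ { zero → refl ; (suc i) → refl }) pf)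
       (any? λ a → ∃-function? (λ f≗g → P-ext (◂-cong a f≗g)) (λ f → P? (a ◂ f)))
  where
    ◂-cong : ∀ a {f g : Fin k → Fin m} → (∀ i → f i ≡ g i) → ∀ i → (a ◂ f) i ≡ (a ◂ g) i
    ◂-cong a f≗g zero    = refl
    ◂-cong a f≗g (suc i) = f≗g i

injective? : ∀ {k m} (f : Fin k → Fin m) → Dec (Injective _≡_ _≡_ f)
injective? f = map′ (λ inj {i} {j} → inj i j) (λ inj i j → inj)
  (all? λ i → all? λ j → (f i ≟ᶠ f j) →-dec (i ≟ᶠ j))

injective-ext : ∀ {k m} → Extensional {k} {m} (Injective _≡_ _≡_)
injective-ext f≗g f-inj {i} {j} gi≡gj = f-inj (trans (f≗g i) (trans gi≡gj (sym (f≗g j))))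

-- c traces a directed cycle of length ℓ + 1; HasCycle A is ∃ ℓ, ∃ (IsCycle A ℓ)
IsCycle : ∀ {m} → (Fin m → Fin m → Bool) → ∀ ℓ → (Fin (suc ℓ) → Fin m) → Set
IsCycle A ℓ c = Injective _≡_ _≡_ c × (∀ i → A (c (inject₁ i)) (c (suc i)) ≡ true)
  × A (c (fromℕ ℓ)) (c zero) ≡ true

isCycle? : ∀ {m} (A : Fin m → Fin m → Bool) ℓ → Decidable (IsCycle A ℓ)
isCycle? A ℓ c = injective? c
  ×-dec all? (λ i → A (c (inject₁ i)) (c (suc i)) ≟ᵇ true)
  ×-dec (A (c (fromℕ ℓ)) (c zero) ≟ᵇ true)

isCycle-ext : ∀ {m} (A : Fin m → Fin m → Bool) ℓ → Extensional (IsCycle A ℓ)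
isCycle-ext A ℓ {c} {d} c≗d (c-inj , arcs , closing) =
  injective-ext c≗d c-inj , (λ i → trans (sym (along _ _)) (arcs i)) , trans (sym (along _ _)) closing
  where
    along : ∀ i j → A (c i) (c j) ≡ A (d i) (d j)
    along i j = cong₂ A (c≗d i) (c≗d j)

-- a cycle visits at most m distinct vertices, so only lengths below m are searched
hasCycle? : ∀ {m} (A : Fin m → Fin m → Bool) → Dec (HasCycle A)
hasCycle? {m} A = map′ (λ (l , c , cycle) → toℕ l , c , cycle) shorten
  (any? λ (l : Fin m) → ∃-function? (isCycle-ext A (toℕ l)) (isCycle? A (toℕ l)))
  where
    shorten : HasCycle A → ∃ λ (l : Fin m) → ∃ (IsCycle A (toℕ l))
    shorten (ℓ , c , cycle) = fromℕ< ℓ<m ,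
      subst (λ t → ∃ (IsCycle A t)) (sym (toℕ-fromℕ< ℓ<m)) (c , cycle)
      where
        ℓ<m = injective⇒≤ (proj₁ cycle)

transitive? : ∀ {n} (T : Tournament n) k → Dec (TransitiveSub T k)
transitive? T k = ∃-function?
  (λ f≗g (f-inj , f-acyclic) → injective-ext f≗g f-inj , acyclic-ext f≗g f-acyclic)
  (λ f → injective? f ×-dec ¬? (hasCycle? (λ i j → adj T (f i) (f j))))
  where
    acyclic-ext : Extensional (Acyclic T)
    acyclic-ext f≗g f-acyclic cycle =
      f-acyclic (cycle-ext (λ i j → cong₂ (adj T) (sym (f≗g i)) (sym (f≗g j))) cycle)

transitive-empty : ∀ {n} (T : Tournament n) → TransitiveSub T 0
transitive-empty T = (λ ()) , (λ {}) , λ (_ , c , _) → ¬Fin0 (c zero)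

transitive-single : ∀ {n} (T : Tournament (suc n)) → TransitiveSub T 1
transitive-single T = (λ _ → zero) , (λ { {zero} {zero} _ → refl }) ,
  λ (_ , _ , _ , _ , closing) → false≢true (trans (sym (irrefl T zero)) closing)
  where
    false≢true : false ≢ true
    false≢true ()

largest : ∀ {n} (T : Tournament n) t → TransBound T t → Σ ℕ λ M → TransitiveSub T M × TransBound T M
largest T zero    bound = 0 , transitive-empty T , bound
largest T (suc t) bound = step (transitive? T (suc t))
  where
    -- the decision is passed as an argument (not via 'with') so that the
    -- type checker does not unfold the exhaustive search
    step : Dec (TransitiveSub T (suc t)) → Σ ℕ λ M → TransitiveSub T M × TransBound T M
    step (yes sub) = suc t , sub , bound
    step (no ¬sub) = largest T t λ k sub → m<1+n⇒m≤n (≤∧≢⇒< (bound k sub) λ { refl → ¬sub sub })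

^-distribʳ-* : ∀ x y k → (x * y) ^ k ≡ x ^ k * y ^ k
^-distribʳ-* x y zero    = refl
^-distribʳ-* x y (suc k) = begin
  x * y * (x * y) ^ k       ≡⟨ cong (x * y *_) (^-distribʳ-* x y k) ⟩
  x * y * (x ^ k * y ^ k)   ≡⟨ interchange x y (x ^ k) (y ^ k) ⟩
  x * x ^ k * (y * y ^ k)   ∎
  where
    open ≡-Reasoning
    interchange : ∀ a b c d → a * b * (c * d) ≡ a * c * (b * d)
    interchange = solve-∀

exp-dominates : ∀ n E → E < (2 + n) ^ E
exp-dominates n zero    = s≤s z≤n
exp-dominates n (suc E) = begin-strict
  suc E                    ≤⟨ exp-dominates n E ⟩
  (2 + n) ^ E              <⟨ m<m*n ((2 + n) ^ E) (2 + n) {{m^n≢0 (2 + n) E}} (s≤s (s≤s z≤n)) ⟩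
  (2 + n) ^ E * (2 + n)    ≡⟨ *-comm ((2 + n) ^ E) (2 + n) ⟩
  (2 + n) ^ suc E          ∎
  where open ≤-Reasoning

-- Read M^q ≤ n^p, i.e. M ≤ n^(p/q), against
-- ((a+1)/b)·(n^E)^(p'/q') ≤ M^E with p/q < p'/q': raising everything to the
-- power q'q and comparing exponents of n leaves n^E ≤ b^(q'q), so the constant
-- (a+1)/b cannot make up for the gap between the exponents once E is large.
amplification : ∀ n M a b p q p' q' E → .{{NonZero n}} → p * q' < p' * q → M ^ q ≤ n ^ p →
  suc a ^ q' * (n ^ E) ^ p' ≤ (M ^ E * b) ^ q' → n ^ E ≤ b ^ (q' * q)
amplification n M a b p q p' q' E cross M-small large = *-cancelˡ-≤ (n ^ P) {{m^n≢0 n P}} (begin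
  n ^ P * n ^ E                     ≡⟨ sym (^-distribˡ-+-* n P E) ⟩
  n ^ (P + E)                       ≤⟨ ^-monoʳ-≤ n exponents ⟩
  n ^ (E * (p' * q))                ≡⟨ sym (trans (^-*-assoc (n ^ E) p' q) (^-*-assoc n E (p' * q))) ⟩
  ((n ^ E) ^ p') ^ q                ≤⟨ ^-monoˡ-≤ q (m≤n*m ((n ^ E) ^ p') (suc a ^ q') {{m^n≢0 (suc a) q'}}) ⟩
  (suc a ^ q' * (n ^ E) ^ p') ^ q   ≤⟨ ^-monoˡ-≤ q large ⟩
  ((M ^ E * b) ^ q') ^ q            ≡⟨ ^-*-assoc (M ^ E * b) q' q ⟩
  (M ^ E * b) ^ Q                   ≡⟨ ^-distribʳ-* (M ^ E) b Q ⟩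
  (M ^ E) ^ Q * b ^ Q               ≡⟨ cong (_* b ^ Q) regroup ⟩
  (M ^ q) ^ (E * q') * b ^ Q        ≤⟨ *-monoˡ-≤ (b ^ Q) (^-monoˡ-≤ (E * q') M-small) ⟩
  (n ^ p) ^ (E * q') * b ^ Q        ≡⟨ cong (_* b ^ Q) (^-*-assoc n p (E * q')) ⟩
  n ^ P * b ^ Q                     ∎)
  where
    open ≤-Reasoning
    P = p * (E * q')
    Q = q' * q
    exponents : P + E ≤ E * (p' * q)
    exponents = begin
      P + E               ≡⟨ split p E q' ⟩
      E * suc (p * q')    ≤⟨ *-monoʳ-≤ E cross ⟩
      E * (p' * q)        ∎
      where
        split : ∀ p E q' → p * (E * q') + E ≡ E * suc (p * q')
        split = solve-∀
    regroup : (M ^ E) ^ Q ≡ (M ^ q) ^ (E * q')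
    regroup = begin-equality
      (M ^ E) ^ Q          ≡⟨ ^-*-assoc M E Q ⟩
      M ^ (E * (q' * q))   ≡⟨ cong (M ^_) (reorder E q' q) ⟩
      M ^ (q * (E * q'))   ≡⟨ sym (^-*-assoc M q (E * q')) ⟩
      (M ^ q) ^ (E * q')   ∎
      where
        reorder : ∀ E q' q → E * (q' * q) ≡ q * (E * q')
        reorder = solve-∀

positive-numerator : ∀ r → 0ℚ <ℚ r → ∃ λ k → ↥ r ≡ + suc k
positive-numerator r@(mkℚ z _ _) 0<r = from-positive z (ℚ.positive 0<r)
  where
    from-positive : ∀ z → ℤ.Positive z → ∃ λ k → z ≡ + suc k
    from-positive +[1+ k ] _  = k , refl
    from-positive (+ 0) record { pos = () }
    from-positive -[1+ k ] record { pos = () }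

cross-multiply : ∀ r r' {p p'} → ↥ r ≡ + p → ↥ r' ≡ + p' → r <ℚ r' → p * ↧ₙ r' < p' * ↧ₙ r
cross-multiply r r' {p} {p'} ↥r≡ ↥r'≡ r<r' = ℤ.drop‿+<+ (subst₂ ℤ._<_
  (trans (cong (ℤ._* ↧ r') ↥r≡) (sym (ℤ.pos-* p (↧ₙ r'))))
  (trans (cong (ℤ._* ↧ r) ↥r'≡) (sym (ℤ.pos-* p' (↧ₙ r))))
  (ℚ.drop-*<* r<r'))

module _ {h} (H : Tournament h) (H-prime : Prime H) (ε c : PosReal)
  (hypothesis : ∀ n (T : Tournament n) → Free H T → HasTransSub T (λ m → AtLeast m c ε n)) where

  -- Let T be H-free on N = n + 2 vertices with α(T) ≤ M.  Then M^q ≤ N^p with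
  -- p/q < p'/q' < ε is impossible: apply the hypothesis to T^E, E = 1 + K,
  -- K = b^(q'q), at the rationals s = (a+1)/b < c and r' = p'/q' < ε; then
  -- amplification gives N^E ≤ K < E, while E < N^E.
  no-gap : ∀ n (T : Tournament (2 + n)) → Free H T → ∀ {M} → TransBound T M →
    ∀ {p q} → M ^ q ≤ (2 + n) ^ p →
    ∀ s r' {a p'} → L c s → L ε r' → 0ℚ <ℚ s → 0ℚ <ℚ r' → ↥ s ≡ + suc a → ↥ r' ≡ + p' →
    p * ↧ₙ r' < p' * q → ⊥
  no-gap n T free {M} bound {p} {q} M-small s r' {a} {p'} s<c r'<ε 0<s 0<r' ↥s≡ ↥r'≡ cross
    with (m , g , g-inj , g-acyclic , large) ←
         hypothesis (pow⁺ (2 + n) (↧ₙ s ^ (↧ₙ r' * q))) (power T (↧ₙ s ^ (↧ₙ r' * q)))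
                    (power-free H T H-prime free (↧ₙ s ^ (↧ₙ r' * q)))
    = <-irrefl refl (begin-strict
      K           <⟨ n<1+n K ⟩
      E           <⟨ exp-dominates n E ⟩
      N ^ E       ≤⟨ amplification N M a b p q p' q' E cross M-small large-at-s,r' ⟩
      K           ∎)
    where
      open ≤-Reasoning
      N  = 2 + n
      b  = ↧ₙ s
      q' = ↧ₙ r'
      Q  = q' * q
      K  = b ^ Q
      E  = suc K
      m-bound : m ≤ M ^ E
      m-bound = power-bound T bound K m (g , g-inj , g-acyclic)
      large-at-s,r' : suc a ^ q' * (N ^ E) ^ p' ≤ (M ^ E * b) ^ q'
      large-at-s,r' = begin
        suc a ^ q' * (N ^ E) ^ p'
          ≡⟨ cong₂ (λ u v → u ^ q' * v ^ p') (cong absℤ (sym ↥s≡)) (sym (pow⁺≡^ N K)) ⟩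
        absℤ (↥ s) ^ q' * pow⁺ N K ^ p'
          ≡⟨ cong (λ v → absℤ (↥ s) ^ q' * pow⁺ N K ^ v) (cong absℤ (sym ↥r'≡)) ⟩
        absℤ (↥ s) ^ q' * pow⁺ N K ^ absℤ (↥ r')
          ≤⟨ large s r' s<c r'<ε 0<s 0<r' ⟩
        (m * b) ^ q'
          ≤⟨ ^-monoˡ-≤ q' (*-monoˡ-≤ b m-bound) ⟩
        (M ^ E * b) ^ q'  ∎

  root-bound : ∀ n (T : Tournament (2 + n)) → Free H T → ∀ {M} → TransBound T M →
    ∀ {p} r → L ε r → 0ℚ <ℚ r → ↥ r ≡ + p → (2 + n) ^ p ≤ M ^ ↧ₙ r
  root-bound n T free {M} bound {p} r r<ε 0<r ↥r≡ with (2 + n) ^ p ≤? M ^ ↧ₙ r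
  ... | yes fits = fits
  ... | no ¬fits =
    let (r' , r<r' , r'<ε)  = rounded ε r<ε
        (s , s<c , 0<s)     = positive c
        0<r'                = ℚ.<-trans 0<r r<r'
        (_ , ↥s≡)           = positive-numerator s 0<s
        (_ , ↥r'≡)          = positive-numerator r' 0<r'
    in ⊥-elim (no-gap n T free bound {p} (<⇒≤ (≰⇒> ¬fits)) s r' s<c r'<ε 0<s 0<r' ↥s≡ ↥r'≡
                 (cross-multiply r r' ↥r≡ ↥r'≡ r<r'))

  exponent-bound : ∀ n (T : Tournament n) → Free H T → ∀ {M} → TransBound T M → AtLeastPow M ε n
  exponent-bound zero T free bound r r<ε 0<r with positive-numerator r 0<r
  ... | _ , ↥r≡ rewrite ↥r≡ = z≤n
  exponent-bound 1 T free {M} bound r r<ε 0<r rewrite ^-zeroˡ (absℤ (↥ r)) =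
    subst (_≤ M ^ ↧ₙ r) (^-zeroˡ (↧ₙ r)) (^-monoˡ-≤ (↧ₙ r) (bound 1 (transitive-single T)))
  exponent-bound (suc (suc n)) T free bound r r<ε 0<r with positive-numerator r 0<r
  ... | _ , ↥r≡ rewrite ↥r≡ = root-bound n T free bound r r<ε 0<r ↥r≡

theorem5 : ∀ {h} (H : Tournament h) → Prime H → (ε : PosReal) →
    Σ PosReal (λ c → ∀ n (T : Tournament n) → Free H T → HasTransSub T (λ m → AtLeast m c ε n)) →
    ∀ n (T : Tournament n) → Free H T → HasTransSub T (λ m → AtLeastPow m ε n)
-- a largest transitive subtournament of T has at least n^ε vertices
theorem5 H H-prime ε (c , hypothesis) n T free =
  let (M , (f , f-inj , f-acyclic) , bound) = largest T n (λ k (_ , f-inj , _) → injective⇒≤ f-inj)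
  in M , f , f-inj , f-acyclic , exponent-bound H H-prime ε c hypothesis n T free bound
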